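{- Let $G$ be a connected finite simple graph of order $n$ and let $s\ge 1$ be an integer with $s\ge \lfloor n/2\rfloor$. Then the $s$-shunt intersection graph $A_s(G)$ is a complete graph.
   Context: For an integer $s\ge1$, an $s$-arc on distinct vertices of $G$ is a sequence $(v_0,\dots,v_s)$ of pairwise distinct vertices with $v_iv_{i+1}\in E(G)$ for $0\le i<s$. Such an $s$-arc $(v_0,\dots,v_s)$ can be shunted onto the $s$-arc $(v_1,\dots,v_{s+1})$ if $(v_0,\dots,v_{s+1})$ is an $(s+1)$-arc on distinct vertices. $A_s(G)$ has as vertices the $s$-arcs on distinct vertices that can be shunted onto some other $s$-arc on distinct vertices; two distinct vertices are adjacent iff the corresponding $s$-arcs share at least one vertex of $G$. -}

module Defs where

open import Data.Nat using (ℕ; zero; suc; _/_; _≥_; _≤_)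
open import Data.Fin using (Fin)
open import Data.Vec using (Vec; []; _∷_; _∷ʳ_; toList; lookup; head; tail)
open import Data.Vec.Relation.Unary.Unique.Propositional using (Unique)
open import Data.Vec.Membership.Propositional using (_∈_)
open import Data.Product using (Σ; ∃; ∃-syntax; _×_; _,_)
open import Relation.Binary.PropositionalEquality using (_≡_)
open import Relation.Nullary using (¬_)
open import Level using (0ℓ)

record SimpleGraph (n : ℕ) : Set₁ where
  field
    Adj   : Fin n → Fin n → Set
    irrefl : ∀ v → ¬ Adj v v
    sym   : ∀ {u v} → Adj u v → Adj v u
open SimpleGraph public

data Walk {n : ℕ} (G : SimpleGraph n) : Fin n → Fin n → Set where
  nil  : ∀ {v} → Walk G v v
  cons : ∀ {u v w} → Adj G u v → Walk G v w → Walk G u w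

Connected : {n : ℕ} → SimpleGraph n → Set
Connected G = ∀ u v → Walk G u v

data Consec {n : ℕ} (G : SimpleGraph n) : {k : ℕ} → Vec (Fin n) k → Set where
  c0 : Consec G []
  c1 : ∀ {v} → Consec G (v ∷ [])
  c2 : ∀ {k u v} {vs : Vec (Fin n) k} →
       Adj G u v → Consec G (v ∷ vs) → Consec G (u ∷ v ∷ vs)

IsArc : {n : ℕ} → SimpleGraph n → (s : ℕ) → Vec (Fin n) (suc s) → Set
IsArc G s a = Unique a × Consec G a

-- An s-arc (v₀,…,v_s) can be shunted onto (v₁,…,v_{s+1}) iff
-- (v₀,…,v_{s+1}) is an (s+1)-arc on distinct vertices.
-- The vertices of A_s(G): s-arcs on distinct vertices that can be shunted
-- onto some other s-arc on distinct vertices.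
Shuntable : {n : ℕ} → SimpleGraph n → (s : ℕ) → Vec (Fin n) (suc s) → Set
Shuntable G s a =
  IsArc G s a × ∃[ w ] (IsArc G s (tail (a ∷ʳ w)) × IsArc G (suc s) (a ∷ʳ w))

VA : {n : ℕ} → SimpleGraph n → ℕ → Set
VA {n} G s = Σ (Vec (Fin n) (suc s)) (Shuntable G s)

AdjA : {n : ℕ} (G : SimpleGraph n) (s : ℕ) → VA G s → VA G s → Set
AdjA G s (a , _) (b , _) = ¬ (a ≡ b) × ∃[ v ] (v ∈ a × v ∈ b)

-- A_s(G) is complete: any two distinct vertices are adjacent.
-- (Vertices of A_s(G) are the arcs themselves, so distinctness is of arcs.)
AsComplete : {n : ℕ} → SimpleGraph n → ℕ → Set
AsComplete G s = ∀ (x y : VA G s) → ¬ (x .Data.Product.proj₁ ≡ y .Data.Product.proj₁) → AdjA G s x y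

-- Two vertices of A_s(G) are s-arcs, i.e. duplicate-free sequences of s + 1 vertices of G.
-- When s ≥ ⌊n/2⌋ their lengths add up to 2s + 2 > n, so by the pigeonhole principle they
-- share a vertex.
module Submission where

open import Defs
open import Data.Nat using (ℕ; _≥_; _/_; _%_; _<_; _≤_; _≤?_; _+_; _*_; suc; s≤s; NonZero)
open import Data.Nat.Properties
  using (+-monoˡ-<; *-monoˡ-≤; *-comm; +-identityʳ; ≰⇒>; <⇒≱; module ≤-Reasoning)
open import Data.Nat.DivMod using (m≡m%n+[m/n]*n; m%n<n)
open import Data.Fin using (Fin)
open import Data.Fin.Properties using (_≟_; pigeonhole; <⇒≢)
open import Data.Vec using (Vec; []; _∷_; _++_; lookup)
open import Data.Vec.Relation.Unary.Any using (Any; here; there; any?)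
open import Data.Vec.Relation.Unary.All using (All; []; _∷_)
import Data.Vec.Relation.Unary.All as All
open import Data.Vec.Relation.Unary.Unique.Propositional using (Unique)
open import Data.Vec.Relation.Unary.Unique.Propositional.Properties using (lookup-injective)
import Data.Vec.Relation.Unary.AllPairs.Properties as AllPairs
open import Data.Vec.Membership.Propositional using (_∈_)
open import Data.Vec.Membership.Propositional.Properties using (fromAny)
open import Data.Product using (∃; _×_; _,_)
open import Relation.Binary.PropositionalEquality using (cong)
open import Relation.Nullary using (¬_; yes; no)
open import Relation.Unary using (Pred)
open import Data.Empty using (⊥-elim)

m/n<o⇒m<o*n : ∀ {m n o} .{{_ : NonZero n}} → m / n < o → m < o * n
m/n<o⇒m<o*n {m} {n} {o} m/n<o = begin-strict
  m                  ≡⟨ m≡m%n+[m/n]*n m n ⟩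
  m % n + m / n * n  <⟨ +-monoˡ-< (m / n * n) (m%n<n m n) ⟩
  suc (m / n) * n    ≤⟨ *-monoˡ-≤ n m/n<o ⟩
  o * n              ∎
  where open ≤-Reasoning

m/2≤n⇒m<[1+n]+[1+n] : ∀ {m n} → m / 2 ≤ n → m < suc n + suc n
m/2≤n⇒m<[1+n]+[1+n] {m} {n} m/2≤n = begin-strict
  m                    <⟨ m/n<o⇒m<o*n (s≤s m/2≤n) ⟩
  suc n * 2            ≡⟨ *-comm (suc n) 2 ⟩
  suc n + (suc n + 0)  ≡⟨ cong (suc n +_) (+-identityʳ (suc n)) ⟩
  suc n + suc n        ∎
  where open ≤-Reasoning

¬Any⇒All¬ : ∀ {a p} {A : Set a} {P : Pred A p} {k} (xs : Vec A k) →
            ¬ Any P xs → All (λ x → ¬ P x) xs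
¬Any⇒All¬ [] _ = []
¬Any⇒All¬ (x ∷ xs) ¬any = (λ px → ¬any (here px)) ∷ ¬Any⇒All¬ xs (λ pxs → ¬any (there pxs))

Unique⇒length≤ : ∀ {n k} {xs : Vec (Fin n) k} → Unique xs → k ≤ n
Unique⇒length≤ {n} {k} {xs} uxs with k ≤? n
... | yes k≤n = k≤n
... | no k≰n with pigeonhole (≰⇒> k≰n) (lookup xs)
...   | i , j , i<j , xsᵢ≡xsⱼ = ⊥-elim (<⇒≢ i<j (lookup-injective uxs i j xsᵢ≡xsⱼ))

Unique-intersect : ∀ {n k m} {xs : Vec (Fin n) k} {ys : Vec (Fin n) m} →
                   Unique xs → Unique ys → n < k + m → ∃ λ v → v ∈ xs × v ∈ ys
Unique-intersect {xs = xs} {ys} uxs uys n<k+m with any? (λ x → any? (x ≟_) ys) xs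
... | yes common = fromAny common
... | no disjoint = ⊥-elim (<⇒≱ n<k+m (Unique⇒length≤ uxs++ys))
  where
  uxs++ys : Unique (xs ++ ys)
  uxs++ys = AllPairs.++⁺ uxs uys (All.map (¬Any⇒All¬ ys) (¬Any⇒All¬ xs disjoint))

mainTheorem2 : (n : ℕ) (G : SimpleGraph n) → Connected G →
    (s : ℕ) → s ≥ 1 → s ≥ n / 2 → AsComplete G s
mainTheorem2 n G _ s _ s≥n/2 (a , (ua , _) , _) (b , (ub , _) , _) a≢b =
  a≢b , Unique-intersect ua ub (m/2≤n⇒m<[1+n]+[1+n] s≥n/2)
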